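{- Let $\alpha=(\alpha_1,\ldots,\alpha_n)$ be a composition of $N$ with all $\alpha_i>0$. The number of permutations (words) of the multiset $\{1^{\alpha_1},\ldots,n^{\alpha_n}\}$ that contain no weakly increasing subsequence of length $3$ is $|S^3_{(1^N)\alpha}|$, and \[ |S^3_{(1^N)\alpha}|=\begin{cases}C_n & \text{if }\alpha\in\{1,2\}^n,\\ 0&\text{otherwise,}\end{cases} \] where $C_n=\frac1{n+1}\binom{2n}{n}$.
   Context: $S_{(1^N)\alpha}$ is identified with the set of words of length $N$ with content $\{1^{\alpha_1},\ldots,n^{\alpha_n}\}$ (each letter $i$ occurring $\alpha_i$ times). $S^3_{(1^N)\alpha}$ is the set of such words having no weakly increasing subsequence of length $3$. -}

module Defs where

open import Data.Nat using (ℕ; zero; suc; _+_; _*_; _<_; _≤_)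
open import Data.Nat.DivMod using (_/_)
open import Data.Nat.Combinatorics using (_C_)
open import Data.Fin using (Fin) renaming (_≤_ to _≤ᶠ_)
open import Data.List using (List; length; lookup; filter)
open import Data.List.Membership.Propositional using (_∈_)
open import Data.List.Relation.Unary.All using (All)
open import Data.List.Relation.Unary.Unique.Propositional using (Unique)
open import Data.Vec using (Vec)
import Data.Vec as Vec
open import Data.Fin using (_≟_)
open import Data.Product using (Σ; ∃; _×_)
open import Relation.Binary.PropositionalEquality using (_≡_)
open import Relation.Nullary using (¬_)
open import Relation.Nullary.Decidable using (does)

catalan : ℕ → ℕ
catalan n = ((n + n) C n) / suc n

count : ∀ {n} → Fin n → List (Fin n) → ℕ
count i w = length (filter (_≟ i) w)

HasContent : ∀ {n} → Vec ℕ n → List (Fin n) → Set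
HasContent {n} α w = (i : Fin n) → count i w ≡ Vec.lookup α i

HasWeakInc3 : ∀ {n} → List (Fin n) → Set
HasWeakInc3 w =
  Σ (Fin (length w)) λ p → Σ (Fin (length w)) λ q → Σ (Fin (length w)) λ r →
    (Data.Fin.toℕ p < Data.Fin.toℕ q) × (Data.Fin.toℕ q < Data.Fin.toℕ r) ×
    (lookup w p ≤ᶠ lookup w q) × (lookup w q ≤ᶠ lookup w r)

InS3 : ∀ {n} → Vec ℕ n → List (Fin n) → Set
InS3 α w = HasContent α w × ¬ HasWeakInc3 w

HasCard : ∀ {n} → (List (Fin n) → Set) → ℕ → Set
HasCard {n} P m = Σ (List (List (Fin n))) λ L →
  Unique L × All P L × (∀ w → P w → w ∈ L) × (length L ≡ m)

AllOneOrTwo : ∀ {n} → Vec ℕ n → Set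
AllOneOrTwo {n} α = (i : Fin n) → (Vec.lookup α i ≡ 1) Data.Sum.⊎ (Vec.lookup α i ≡ 2)
  where import Data.Sum

-- Build a word of S³ by inserting the copies of its largest letter t into a word v
-- on the smaller letters.  Since no letter may be followed by two weakly larger ones,
-- a single t can only go among the first d + 1 positions of v, where d is the length of
-- the strictly decreasing prefix of v; a doubled t must stand in front, with its second
-- copy again among those positions.  Either way, a new word with decreasing prefix of
-- length ℓ + 1 comes from exactly one v with prefix length j ≥ ℓ, so the number B(k, ℓ)
-- of such words on k letters obeys B(k+1, ℓ+1) = Σ_{j ≥ ℓ} B(k, j) whatever α ∈ {1,2}ⁿ.
-- These are ballot numbers, B(k+1, ℓ+1) = C(2k-ℓ, k) - C(2k-ℓ, k+1), and summing over
-- ℓ gives C(2n, n) - C(2n, n+1) = Cₙ.  A letter occurring three times is on its own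
-- a weakly increasing subsequence of length 3.

module Submission where

open import Defs
open import Data.Nat using (ℕ; _<_)
open import Data.Vec using (Vec; lookup)
open import Data.Fin using (Fin)
open import Data.Product using (_×_)
open import Relation.Nullary using (¬_)

open import Data.Nat using (zero; suc; _+_; _∸_; _*_; _≤_; z≤n; s≤s)
import Data.Nat.Properties as ℕ
open import Data.Nat.Combinatorics using (_C_; nCk+nC[k+1]≡[n+1]C[k+1]; nCk≡nC[n∸k]; nCn≡1; nC1≡n; k>n⇒nCk≡0)
open import Data.Nat.DivMod using (_/_; m*n/n≡m)
open import Data.Nat.Solver using (module +-*-Solver)
open import Algebra.Properties.CommutativeSemigroup ℕ.+-commutativeSemigroup using (interchange; x∙yz≈y∙xz)
open import Data.Fin using (zero; suc; toℕ; fromℕ<; _≟_; _<?_) renaming (_≤_ to _≤ᶠ_; _<_ to _<ᶠ_)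
import Data.Fin.Properties as Fin
open import Data.List using (List; []; _∷_; _++_; map; length; take) renaming (lookup to _!_)
import Data.List.Properties as List
open import Data.List.Membership.Propositional using (_∈_; lose)
open import Data.List.Membership.Propositional.Properties using (∈-++⁺ˡ; ∈-++⁺ʳ; ∈-map⁺; ∈-lookup)
open import Data.List.Relation.Unary.All as All using (All; []; _∷_)
open import Data.List.Relation.Unary.All.Properties using (++⁺; map⁺; All¬⇒¬Any)
open import Data.List.Relation.Binary.Sublist.Propositional using (_⊆_; []; _∷_; _∷ʳ_; ⊆-refl)
open import Data.List.Relation.Binary.Sublist.Propositional.Properties using (Any-resp-⊆)
open import Data.List.Relation.Unary.Any as Any using (Any; here; there)
open import Data.List.Relation.Unary.Any.Properties using (lookup-index)
open import Data.List.Relation.Unary.AllPairs using ([]; _∷_)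
import Data.List.Relation.Unary.Unique.Propositional.Properties as Unique
open import Data.Product using (Σ; ∃-syntax; _,_; proj₂)
open import Data.Sum using (_⊎_; inj₁; inj₂)
open import Data.Empty using (⊥-elim)
open import Function using (_∘_)
open import Function.Definitions using (Injective)
open import Relation.Binary.PropositionalEquality
open import Relation.Nullary using (Dec; yes; no)
open import Relation.Nullary.Decidable using (_⊎-dec_)

Word : ℕ → Set
Word n = List (Fin n)

-- Counting finite sets of words

sumFrom : ℕ → ℕ → (ℕ → ℕ) → ℕ
sumFrom a zero    m = 0
sumFrom a (suc c) m = m a + sumFrom (suc a) c m

module _ {n : ℕ} where

  HasCard-resp : ∀ {P Q : Word n → Set} {m} →
    (∀ w → P w → Q w) → (∀ w → Q w → P w) → HasCard P m → HasCard Q m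
  HasCard-resp P⇒Q Q⇒P (L , unique , all , complete , len) =
    L , unique , All.map (P⇒Q _) all , (λ w → complete w ∘ Q⇒P w) , len

  HasCard-∅ : ∀ {P : Word n → Set} → (∀ w → ¬ P w) → HasCard P 0
  HasCard-∅ ¬P = [] , [] , [] , (λ w → ⊥-elim ∘ ¬P w) , refl

  HasCard-singleton : ∀ {P : Word n → Set} w₀ → P w₀ → (∀ w → P w → w ≡ w₀) → HasCard P 1
  HasCard-singleton w₀ Pw₀ unique = (w₀ ∷ []) , ([] ∷ []) , (Pw₀ ∷ []) , (λ w → here ∘ unique w) , refl

  HasCard-⊎ : ∀ {P Q : Word n → Set} {a b} → (∀ w → P w → ¬ Q w) →
    HasCard P a → HasCard Q b → HasCard (λ w → P w ⊎ Q w) (a + b)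
  HasCard-⊎ {P} {Q} disjoint (L₁ , u₁ , a₁ , c₁ , l₁) (L₂ , u₂ , a₂ , c₂ , l₂) =
    L₁ ++ L₂ , Unique.++⁺ u₁ u₂ (λ (i₁ , i₂) → disjoint _ (All.lookup a₁ i₁) (All.lookup a₂ i₂)) ,
    ++⁺ (All.map inj₁ a₁) (All.map inj₂ a₂) , complete , trans (List.length-++ L₁) (cong₂ _+_ l₁ l₂)
    where
    complete : ∀ w → P w ⊎ Q w → w ∈ L₁ ++ L₂
    complete w (inj₁ p) = ∈-++⁺ˡ (c₁ w p)
    complete w (inj₂ q) = ∈-++⁺ʳ L₁ (c₂ w q)

  Image : (Word n → Word n) → (Word n → Set) → Word n → Set
  Image f P w = Σ (Word n) λ v → P v × w ≡ f v

  HasCard-Image : ∀ {P : Word n → Set} {m} (f : Word n → Word n) → Injective _≡_ _≡_ f →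
    HasCard P m → HasCard (Image f P) m
  HasCard-Image f f-inj (L , unique , all , complete , len) =
    map f L , Unique.map⁺ f-inj unique , map⁺ (All.map (λ {v} p → v , p , refl) all) ,
    (λ { w (v , p , refl) → ∈-map⁺ f (complete v p) }) , trans (List.length-map f L) len

  ⋃Range : ℕ → ℕ → (ℕ → Word n → Set) → Word n → Set
  ⋃Range a c Q w = ∃[ j ] (a ≤ j × j < a + c × Q j w)

  HasCard-⋃Range : ∀ (Q : ℕ → Word n → Set) (m : ℕ → ℕ) →
    (∀ {i j w} → Q i w → Q j w → i ≡ j) → (∀ j → HasCard (Q j) (m j)) →
    ∀ a c → HasCard (⋃Range a c Q) (sumFrom a c m)
  HasCard-⋃Range Q m functional card a zero =
    HasCard-∅ λ { w (j , a≤j , j<a+0 , _) →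
      ℕ.<-irrefl refl (ℕ.≤-<-trans a≤j (subst (j <_) (ℕ.+-identityʳ a) j<a+0)) }
  HasCard-⋃Range Q m functional card a (suc c) =
    HasCard-resp split unsplit (HasCard-⊎ disjoint (card a) (HasCard-⋃Range Q m functional card (suc a) c))
    where
    disjoint : ∀ w → Q a w → ¬ ⋃Range (suc a) c Q w
    disjoint w Qa (j , a<j , _ , Qj) with functional Qa Qj
    ... | refl = ℕ.<-irrefl refl a<j
    split : ∀ w → Q a w ⊎ ⋃Range (suc a) c Q w → ⋃Range a (suc c) Q w
    split w (inj₁ Qa) = a , ℕ.≤-refl , subst (a <_) (sym (ℕ.+-suc a c)) (s≤s (ℕ.m≤m+n a c)) , Qa
    split w (inj₂ (j , a<j , j<1+a+c , Qj)) = j , ℕ.<⇒≤ a<j , subst (j <_) (sym (ℕ.+-suc a c)) j<1+a+c , Qj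
    unsplit : ∀ w → ⋃Range a (suc c) Q w → Q a w ⊎ ⋃Range (suc a) c Q w
    unsplit w (j , a≤j , j<a+1+c , Qj) with ℕ.m≤n⇒m<n∨m≡n a≤j
    ... | inj₂ refl = inj₁ Qj
    ... | inj₁ a<j  = inj₂ (j , a<j , subst (j <_) (ℕ.+-suc a c) j<a+1+c , Qj)

  HasCard-⋃Range-Image : ∀ (f : Word n → Word n) → Injective _≡_ _≡_ f →
    (Q : ℕ → Word n → Set) (m : ℕ → ℕ) →
    (∀ {i j w} → Q i w → Q j w → i ≡ j) → (∀ j → HasCard (Q j) (m j)) →
    ∀ a c → HasCard (⋃Range a c (λ j → Image f (Q j))) (sumFrom a c m)
  HasCard-⋃Range-Image f f-inj Q m functional card =
    HasCard-⋃Range (λ j → Image f (Q j)) m functional′ (λ j → HasCard-Image f f-inj (card j))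
    where
    functional′ : ∀ {i j w} → Image f (Q i) w → Image f (Q j) w → i ≡ j
    functional′ (v , Qiv , refl) (v′ , Qjv′ , eq) with f-inj eq
    ... | refl = functional Qiv Qjv′

-- Weakly increasing subsequences of length 3

module _ {n : ℕ} where

  data IncPairFrom (x : Fin n) : Word n → Set where
    start : ∀ {y w} → x ≤ᶠ y → Any (y ≤ᶠ_) w → IncPairFrom x (y ∷ w)
    skip  : ∀ {y w} → IncPairFrom x w → IncPairFrom x (y ∷ w)

  data WeakInc3 : Word n → Set where
    start : ∀ {x w} → IncPairFrom x w → WeakInc3 (x ∷ w)
    skip  : ∀ {x w} → WeakInc3 w → WeakInc3 (x ∷ w)

  IncPairFrom⇒positions : ∀ {x w} → IncPairFrom x w →
    Σ (Fin (length w)) λ q → Σ (Fin (length w)) λ r →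
      toℕ q < toℕ r × x ≤ᶠ w ! q × w ! q ≤ᶠ w ! r
  IncPairFrom⇒positions (start x≤y y≤) = zero , suc (Any.index y≤) , s≤s z≤n , x≤y , lookup-index y≤
  IncPairFrom⇒positions (skip pair) =
    let q , r , q<r , x≤ , ≤r = IncPairFrom⇒positions pair
    in suc q , suc r , s≤s q<r , x≤ , ≤r

  positions⇒IncPairFrom : ∀ {x} (w : Word n) (q r : Fin (length w)) → toℕ q < toℕ r →
    x ≤ᶠ w ! q → w ! q ≤ᶠ w ! r → IncPairFrom x w
  positions⇒IncPairFrom (y ∷ w) zero    (suc r) _         x≤y y≤ =
    start x≤y (lose (∈-lookup r) y≤)
  positions⇒IncPairFrom (y ∷ w) (suc q) (suc r) (s≤s q<r) x≤  ≤r =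
    skip (positions⇒IncPairFrom w q r q<r x≤ ≤r)

  WeakInc3⇒HasWeakInc3 : ∀ {w} → WeakInc3 w → HasWeakInc3 w
  WeakInc3⇒HasWeakInc3 (start pair) =
    let q , r , q<r , x≤ , ≤r = IncPairFrom⇒positions pair
    in zero , suc q , suc r , s≤s z≤n , s≤s q<r , x≤ , ≤r
  WeakInc3⇒HasWeakInc3 (skip inc) =
    let p , q , r , p<q , q<r , ≤q , ≤r = WeakInc3⇒HasWeakInc3 inc
    in suc p , suc q , suc r , s≤s p<q , s≤s q<r , ≤q , ≤r

  HasWeakInc3⇒WeakInc3 : ∀ w → HasWeakInc3 w → WeakInc3 w
  HasWeakInc3⇒WeakInc3 (x ∷ w) (zero , suc q , suc r , _ , s≤s q<r , x≤ , ≤r) =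
    start (positions⇒IncPairFrom w q r q<r x≤ ≤r)
  HasWeakInc3⇒WeakInc3 (x ∷ w) (suc p , suc q , suc r , s≤s p<q , s≤s q<r , ≤q , ≤r) =
    skip (HasWeakInc3⇒WeakInc3 w (p , q , r , p<q , q<r , ≤q , ≤r))

-- Letter counts and insertion

module _ {n : ℕ} where

  count-∷-≡ : ∀ x (w : Word n) → count x (x ∷ w) ≡ suc (count x w)
  count-∷-≡ x w with x ≟ x
  ... | yes _  = refl
  ... | no x≢x = ⊥-elim (x≢x refl)

  count-∷-≢ : ∀ {x i} (w : Word n) → x ≢ i → count i (x ∷ w) ≡ count i w
  count-∷-≢ {x} {i} w x≢i with x ≟ i
  ... | yes x≡i = ⊥-elim (x≢i x≡i)
  ... | no _    = refl

  count≡0⇒[] : ∀ (w : Word n) → (∀ i → count i w ≡ 0) → w ≡ []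
  count≡0⇒[] []      _      = refl
  count≡0⇒[] (x ∷ w) count≡0 with trans (sym (count-∷-≡ x w)) (count≡0 x)
  ... | ()

  ∈⇒count≡suc : ∀ {y} {w : Word n} → y ∈ w → ∃[ c ] count y w ≡ suc c
  ∈⇒count≡suc {y} {x ∷ w} (here refl) = count y w , count-∷-≡ y w
  ∈⇒count≡suc {y} {x ∷ w} (there y∈w) with x ≟ y | ∈⇒count≡suc y∈w
  ... | yes _ | c , eq = suc c , cong suc eq
  ... | no _  | c , eq = c , eq

  count≡suc⇒∈ : ∀ {t} (w : Word n) {c} → count t w ≡ suc c → t ∈ w
  count≡suc⇒∈ {t} (x ∷ w) eq with x ≟ t
  ... | yes refl = here refl
  ... | no _     = there (count≡suc⇒∈ w eq)

  count≡2⇒IncPairFrom : ∀ {x t} (w : Word n) {c} → x ≤ᶠ t → count t w ≡ suc (suc c) → IncPairFrom x w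
  count≡2⇒IncPairFrom {t = t} (y ∷ w) x≤t eq with y ≟ t
  ... | yes refl = start x≤t (lose (count≡suc⇒∈ w (ℕ.suc-injective eq)) ℕ.≤-refl)
  ... | no _     = skip (count≡2⇒IncPairFrom w x≤t eq)

  count≡3⇒WeakInc3 : ∀ t (w : Word n) {c} → count t w ≡ suc (suc (suc c)) → WeakInc3 w
  count≡3⇒WeakInc3 t (y ∷ w) eq with y ≟ t
  ... | yes refl = start (count≡2⇒IncPairFrom w ℕ.≤-refl (ℕ.suc-injective eq))
  ... | no _     = skip (count≡3⇒WeakInc3 t w eq)

  insert : ℕ → Fin n → Word n → Word n
  insert zero    t v       = t ∷ v
  insert (suc p) t []      = t ∷ []
  insert (suc p) t (x ∷ v) = x ∷ insert p t v

  insert≢[] : ∀ p t (v : Word n) → insert p t v ≢ []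
  insert≢[] zero    t v       ()
  insert≢[] (suc p) t []      ()
  insert≢[] (suc p) t (x ∷ v) ()

  insert-injective : ∀ p t → Injective _≡_ _≡_ (insert p t)
  insert-injective zero    t refl = refl
  insert-injective (suc p) t {[]}    {[]}     _  = refl
  insert-injective (suc p) t {[]}    {x ∷ v′} eq =
    ⊥-elim (insert≢[] p t v′ (sym (proj₂ (List.∷-injective eq))))
  insert-injective (suc p) t {x ∷ v} {[]}     eq =
    ⊥-elim (insert≢[] p t v (proj₂ (List.∷-injective eq)))
  insert-injective (suc p) t {x ∷ v} {y ∷ v′} eq with List.∷-injective eq
  ... | refl , eq′ = cong (x ∷_) (insert-injective p t eq′)

  count-insert-≡ : ∀ p t (v : Word n) → count t (insert p t v) ≡ suc (count t v)
  count-insert-≡ zero    t v       = count-∷-≡ t v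
  count-insert-≡ (suc p) t []      = count-∷-≡ t []
  count-insert-≡ (suc p) t (x ∷ v) with x ≟ t
  ... | yes _ = cong suc (count-insert-≡ p t v)
  ... | no _  = count-insert-≡ p t v

  count-insert-≢ : ∀ p {t i} (v : Word n) → t ≢ i → count i (insert p t v) ≡ count i v
  count-insert-≢ zero          v       t≢i = count-∷-≢ v t≢i
  count-insert-≢ (suc p)       []      t≢i = count-∷-≢ [] t≢i
  count-insert-≢ (suc p) {i = i} (x ∷ v) t≢i with x ≟ i
  ... | yes _ = cong suc (count-insert-≢ p v t≢i)
  ... | no _  = count-insert-≢ p v t≢i

  extractFirst : ∀ t (w : Word n) {c} → count t w ≡ suc c →
    ∃[ p ] ∃[ v ] (p ≤ length v × w ≡ insert p t v)
  extractFirst t (x ∷ w) eq with x ≟ t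
  ... | yes refl = 0 , w , z≤n , refl
  ... | no _     =
    let p , v , p≤ , w≡ = extractFirst t w eq
    in suc p , x ∷ v , s≤s p≤ , cong (x ∷_) w≡

-- Inserting a letter larger than all others

module _ {n : ℕ} where

  insert-⊆ : ∀ p t (v : Word n) → v ⊆ insert p t v
  insert-⊆ zero    t v       = t ∷ʳ ⊆-refl
  insert-⊆ (suc p) t []      = t ∷ʳ []
  insert-⊆ (suc p) t (x ∷ v) = refl ∷ insert-⊆ p t v

  ∈-insert : ∀ p t (v : Word n) → t ∈ insert p t v
  ∈-insert zero    t v       = here refl
  ∈-insert (suc p) t []      = here refl
  ∈-insert (suc p) t (x ∷ v) = there (∈-insert p t v)

  IncPairFrom-resp-⊆ : ∀ {x} {v w : Word n} → v ⊆ w → IncPairFrom x v → IncPairFrom x w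
  IncPairFrom-resp-⊆ (y ∷ʳ v⊆w)   pair              = skip (IncPairFrom-resp-⊆ v⊆w pair)
  IncPairFrom-resp-⊆ (refl ∷ v⊆w) (start x≤y y≤) = start x≤y (Any-resp-⊆ v⊆w y≤)
  IncPairFrom-resp-⊆ (refl ∷ v⊆w) (skip pair)       = skip (IncPairFrom-resp-⊆ v⊆w pair)

  WeakInc3-resp-⊆ : ∀ {v w : Word n} → v ⊆ w → WeakInc3 v → WeakInc3 w
  WeakInc3-resp-⊆ (y ∷ʳ v⊆w)   inc          = skip (WeakInc3-resp-⊆ v⊆w inc)
  WeakInc3-resp-⊆ (refl ∷ v⊆w) (start pair) = start (IncPairFrom-resp-⊆ v⊆w pair)
  WeakInc3-resp-⊆ (refl ∷ v⊆w) (skip inc)   = skip (WeakInc3-resp-⊆ v⊆w inc)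

  IncPairFrom⇒Any : ∀ {x} {w : Word n} → IncPairFrom x w → Any (x ≤ᶠ_) w
  IncPairFrom⇒Any (start x≤y _) = here x≤y
  IncPairFrom⇒Any (skip pair)   = there (IncPairFrom⇒Any pair)

  All<⇒¬Any≥ : ∀ {t : Fin n} {v : Word n} → All (_<ᶠ t) v → ¬ Any (t ≤ᶠ_) v
  All<⇒¬Any≥ v<t = All¬⇒¬Any (All.map (λ {y} → ℕ.<⇒≱ {toℕ y}) v<t)

  -- Matching on Dec, rather than using if_then_else_ on does, lets `with y <? x` reduce
  -- decPrefixLength.
  extendIf : ∀ {P : Set} → Dec P → ℕ → ℕ
  extendIf (yes _) l = suc l
  extendIf (no _)  _ = 1

  decPrefixLength : Word n → ℕ
  decPrefixLength []          = 0
  decPrefixLength (x ∷ [])    = 1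
  decPrefixLength (x ∷ y ∷ w) = extendIf (y <? x) (decPrefixLength (y ∷ w))

  decPrefixLength-∷-pos : ∀ x (w : Word n) → 0 < decPrefixLength (x ∷ w)
  decPrefixLength-∷-pos x []      = s≤s z≤n
  decPrefixLength-∷-pos x (y ∷ w) with y <? x
  ... | yes _ = s≤s z≤n
  ... | no _  = s≤s z≤n

  decPrefixLength≡0⇒[] : ∀ (w : Word n) → decPrefixLength w ≡ 0 → w ≡ []
  decPrefixLength≡0⇒[] []      _  = refl
  decPrefixLength≡0⇒[] (x ∷ w) eq = ⊥-elim (ℕ.<-irrefl (sym eq) (decPrefixLength-∷-pos x w))

  decPrefixLength-∷-≤ : ∀ x (w : Word n) → decPrefixLength (x ∷ w) ≤ suc (decPrefixLength w)
  decPrefixLength-∷-≤ x []      = ℕ.≤-refl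
  decPrefixLength-∷-≤ x (y ∷ w) with y <? x
  ... | yes _ = ℕ.≤-refl
  ... | no _  = s≤s z≤n

  decPrefixLength-∷-≤-head : ∀ x (w : Word n) → decPrefixLength (x ∷ w) ≤ suc (toℕ x)
  decPrefixLength-∷-≤-head x []      = s≤s z≤n
  decPrefixLength-∷-≤-head x (y ∷ w) with y <? x
  ... | yes y<x = s≤s (ℕ.≤-trans (decPrefixLength-∷-≤-head y w) y<x)
  ... | no _    = s≤s z≤n

  decPrefixLength-≤ : ∀ {k} (w : Word n) → All (λ y → toℕ y < k) w → decPrefixLength w ≤ k
  decPrefixLength-≤ []      _           = z≤n
  decPrefixLength-≤ (x ∷ w) (x<k ∷ _) = ℕ.≤-trans (decPrefixLength-∷-≤-head x w) x<k

  decPrefixLength-∷-max : ∀ {t} (v : Word n) → All (_<ᶠ t) v →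
    decPrefixLength (t ∷ v) ≡ suc (decPrefixLength v)
  decPrefixLength-∷-max {t} []      _          = refl
  decPrefixLength-∷-max {t} (y ∷ v) (y<t ∷ _) with y <? t
  ... | yes _   = refl
  ... | no y≮t = ⊥-elim (y≮t y<t)

  decPrefixLength-∷-unfold : ∀ x (v : Word n) p → suc (suc p) ≤ decPrefixLength (x ∷ v) →
    ∃[ y ] ∃[ v′ ] (v ≡ y ∷ v′ × y <ᶠ x × suc p ≤ decPrefixLength (y ∷ v′))
  decPrefixLength-∷-unfold x []      p (s≤s ())
  decPrefixLength-∷-unfold x (y ∷ v) p 2+p≤ with y <? x
  ... | yes y<x = y , v , refl , y<x , ℕ.≤-pred 2+p≤
  decPrefixLength-∷-unfold x (y ∷ v) p (s≤s ()) | no _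

  decPrefixLength-prefix : ∀ x (v : Word n) p → suc p ≤ decPrefixLength (x ∷ v) → All (_<ᶠ x) (take p v)
  decPrefixLength-prefix x v zero    _    = []
  decPrefixLength-prefix x v (suc p) 2+p≤ with decPrefixLength-∷-unfold x v p 2+p≤
  ... | y , v′ , refl , y<x , 1+p≤ =
    y<x ∷ All.map (λ z<y → ℕ.<-trans z<y y<x) (decPrefixLength-prefix y v′ p 1+p≤)

  decPrefixLength-insert : ∀ {t} p (v : Word n) → All (_<ᶠ t) v → suc p ≤ decPrefixLength v →
    decPrefixLength (insert (suc p) t v) ≡ suc p
  decPrefixLength-insert {t} zero (x ∷ v) (x<t ∷ _) _ with t <? x
  ... | yes t<x = ⊥-elim (ℕ.<-asym x<t t<x)
  ... | no _    = refl
  decPrefixLength-insert {t} (suc p) (x ∷ v) (_ ∷ v<t) 2+p≤ with decPrefixLength-∷-unfold x v p 2+p≤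
  ... | y , v′ , refl , y<x , 1+p≤ with y <? x
  ...   | yes _   = cong suc (decPrefixLength-insert p (y ∷ v′) v<t 1+p≤)
  ...   | no y≮x = ⊥-elim (y≮x y<x)

  decPrefixLength-∷-insert : ∀ {t} p (v : Word n) → All (_<ᶠ t) v → p ≤ decPrefixLength v →
    decPrefixLength (t ∷ insert p t v) ≡ suc p
  decPrefixLength-∷-insert {t} zero v _ _ with t <? t
  ... | yes t<t = ⊥-elim (ℕ.<-irrefl refl t<t)
  ... | no _    = refl
  decPrefixLength-∷-insert {t} (suc p) (x ∷ v) (x<t ∷ v<t) 1+p≤ with x <? t
  ... | yes _   = cong suc (decPrefixLength-insert p (x ∷ v) (x<t ∷ v<t) 1+p≤)
  ... | no x≮t = ⊥-elim (x≮t x<t)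

  IncPairFrom-insert⁻ : ∀ {x t} p (v : Word n) → All (_<ᶠ t) v → All (_<ᶠ x) (take p v) →
    IncPairFrom x (insert p t v) → IncPairFrom x v
  IncPairFrom-insert⁻ zero    v       v<t       _         (start _ t≤)  = ⊥-elim (All<⇒¬Any≥ v<t t≤)
  IncPairFrom-insert⁻ zero    v       _         _         (skip pair)   = pair
  IncPairFrom-insert⁻ (suc p) []      _         _         (start _ ())
  IncPairFrom-insert⁻ (suc p) []      _         _         (skip ())
  IncPairFrom-insert⁻ (suc p) (y ∷ v) _         (y<x ∷ _) (start x≤y _) = ⊥-elim (ℕ.<⇒≱ y<x x≤y)
  IncPairFrom-insert⁻ (suc p) (y ∷ v) (_ ∷ v<t) (_ ∷ v<x) (skip pair)   =
    skip (IncPairFrom-insert⁻ p v v<t v<x pair)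

  ¬IncPairFrom-insert-max : ∀ {t} p (v : Word n) → All (_<ᶠ t) v → ¬ IncPairFrom t (insert p t v)
  ¬IncPairFrom-insert-max zero    v       v<t       (start _ t≤)  = All<⇒¬Any≥ v<t t≤
  ¬IncPairFrom-insert-max zero    v       v<t       (skip pair)   = All<⇒¬Any≥ v<t (IncPairFrom⇒Any pair)
  ¬IncPairFrom-insert-max (suc p) []      _         (start _ ())
  ¬IncPairFrom-insert-max (suc p) []      _         (skip ())
  ¬IncPairFrom-insert-max (suc p) (x ∷ v) (x<t ∷ _) (start t≤x _) = ℕ.<⇒≱ x<t t≤x
  ¬IncPairFrom-insert-max (suc p) (x ∷ v) (_ ∷ v<t) (skip pair)   = ¬IncPairFrom-insert-max p v v<t pair

  ¬WeakInc3-insert : ∀ {t} p (v : Word n) → All (_<ᶠ t) v → p ≤ decPrefixLength v →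
    ¬ WeakInc3 v → ¬ WeakInc3 (insert p t v)
  ¬WeakInc3-insert zero    v       v<t _ _    (start pair) = All<⇒¬Any≥ v<t (IncPairFrom⇒Any pair)
  ¬WeakInc3-insert zero    v       _   _ ¬inc (skip inc)   = ¬inc inc
  ¬WeakInc3-insert (suc p) []      _   () _
  ¬WeakInc3-insert (suc p) (x ∷ v) (_ ∷ v<t) 1+p≤ ¬inc (start pair) =
    ¬inc (start (IncPairFrom-insert⁻ p v v<t (decPrefixLength-prefix x v p 1+p≤) pair))
  ¬WeakInc3-insert (suc p) (x ∷ v) (_ ∷ v<t) 1+p≤ ¬inc (skip inc) =
    ¬WeakInc3-insert p v v<t (ℕ.≤-pred (ℕ.≤-trans 1+p≤ (decPrefixLength-∷-≤ x v))) (¬inc ∘ skip) inc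

  ¬WeakInc3-insert⁻ : ∀ {t} p (v : Word n) → All (_<ᶠ t) v → p ≤ length v →
    ¬ WeakInc3 (insert p t v) → p ≤ decPrefixLength v
  ¬WeakInc3-insert⁻ zero          v           _   _         _ = z≤n
  ¬WeakInc3-insert⁻ (suc zero)    (x ∷ v)     _   _         _ = decPrefixLength-∷-pos x v
  ¬WeakInc3-insert⁻ (suc (suc p)) (x ∷ [])    _   (s≤s ())  _
  ¬WeakInc3-insert⁻ {t} (suc (suc p)) (x ∷ y ∷ v) (_ ∷ y<t ∷ v<t) (s≤s p≤) ¬inc with y <? x
  ... | yes _   = s≤s (¬WeakInc3-insert⁻ (suc p) (y ∷ v) (y<t ∷ v<t) p≤ (¬inc ∘ skip))
  ... | no y≮x = ⊥-elim (¬inc (start (start (ℕ.≮⇒≥ y≮x) (lose (∈-insert p t v) (ℕ.<⇒≤ y<t)))))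

-- Words counted by the length of their strictly decreasing prefix

ballot : ℕ → ℕ → ℕ
ballot zero    zero    = 1
ballot zero    (suc _) = 0
ballot (suc k) zero    = 0
ballot (suc k) (suc ℓ) = sumFrom ℓ (suc (k ∸ ℓ)) (ballot k)

ballot-> : ∀ {k ℓ} → k < ℓ → ballot k ℓ ≡ 0
ballot-> {zero}  {suc ℓ} _         = refl
ballot-> {suc k} {suc ℓ} (s≤s k<ℓ) rewrite ℕ.m≤n⇒m∸n≡0 (ℕ.<⇒≤ k<ℓ) | ballot-> k<ℓ = refl

module Stages {n : ℕ} (α : Vec ℕ n) where

  αBelow : ℕ → Fin n → ℕ
  αBelow k i with toℕ i ℕ.<? k
  ... | yes _ = lookup α i
  ... | no _  = 0

  αBelow-< : ∀ {k i} → toℕ i < k → αBelow k i ≡ lookup α i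
  αBelow-< {k} {i} i<k with toℕ i ℕ.<? k
  ... | yes _   = refl
  ... | no i≮k = ⊥-elim (i≮k i<k)

  αBelow-≥ : ∀ {k i} → k ≤ toℕ i → αBelow k i ≡ 0
  αBelow-≥ {k} {i} k≤i with toℕ i ℕ.<? k
  ... | yes i<k = ⊥-elim (ℕ.<⇒≱ i<k k≤i)
  ... | no _    = refl

  αBelow-suc-≢ : ∀ {k t i} → toℕ t ≡ k → i ≢ t → αBelow (suc k) i ≡ αBelow k i
  αBelow-suc-≢ {k} {t} {i} t≡k i≢t with toℕ i ℕ.<? suc k | toℕ i ℕ.<? k
  ... | yes _      | yes _   = refl
  ... | no _       | no _    = refl
  ... | no i≮1+k  | yes i<k = ⊥-elim (i≮1+k (ℕ.m<n⇒m<1+n i<k))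
  ... | yes i<1+k | no i≮k  =
    ⊥-elim (i≢t (Fin.toℕ-injective (trans (ℕ.≤-antisym (ℕ.≤-pred i<1+k) (ℕ.≮⇒≥ i≮k)) (sym t≡k))))

  ContentBelow : ℕ → Word n → Set
  ContentBelow k w = ∀ i → count i w ≡ αBelow k i

  S3Below : ℕ → Word n → Set
  S3Below k w = ContentBelow k w × ¬ WeakInc3 w

  S3BelowPrefix : ℕ → ℕ → Word n → Set
  S3BelowPrefix k ℓ w = S3Below k w × decPrefixLength w ≡ ℓ

  S3BelowPrefix-functional : ∀ k {i j w} → S3BelowPrefix k i w → S3BelowPrefix k j w → i ≡ j
  S3BelowPrefix-functional _ (_ , eq) (_ , eq′) = trans (sym eq) eq′

  ContentBelow-zero⇒[] : ∀ w → ContentBelow 0 w → w ≡ []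
  ContentBelow-zero⇒[] w content = count≡0⇒[] w (λ i → trans (content i) (αBelow-≥ {i = i} z≤n))

  ContentBelow⇒All< : ∀ {k} (w : Word n) → ContentBelow k w → All (λ y → toℕ y < k) w
  ContentBelow⇒All< {k} w content = All.tabulate letter<k
    where
    letter<k : ∀ {y} → y ∈ w → toℕ y < k
    letter<k {y} y∈w = ℕ.≰⇒> λ k≤y →
      ℕ.0≢1+n (trans (sym (αBelow-≥ k≤y)) (trans (sym (content y)) (proj₂ (∈⇒count≡suc y∈w))))

  module NewLetter {k} {t : Fin n} (t≡k : toℕ t ≡ k) where

    αBelow-new : αBelow (suc k) t ≡ lookup α t
    αBelow-new = αBelow-< (s≤s (ℕ.≤-reflexive t≡k))

    αBelow-old : αBelow k t ≡ 0
    αBelow-old = αBelow-≥ (ℕ.≤-reflexive (sym t≡k))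

    ContentBelow⇒All<t : ∀ (v : Word n) → ContentBelow k v → All (_<ᶠ t) v
    ContentBelow⇒All<t v content =
      All.map (λ {y} y<k → subst (toℕ y <_) (sym t≡k) y<k) (ContentBelow⇒All< v content)

    count-insert-new : ∀ p (v : Word n) → ContentBelow k v → count t (insert p t v) ≡ 1
    count-insert-new p v content = trans (count-insert-≡ p t v) (cong suc (trans (content t) αBelow-old))

    count-insert-old : ∀ p (v : Word n) → ContentBelow k v →
      ∀ i → i ≢ t → count i (insert p t v) ≡ αBelow (suc k) i
    count-insert-old p v content i i≢t =
      trans (count-insert-≢ p v (i≢t ∘ sym)) (trans (content i) (sym (αBelow-suc-≢ t≡k i≢t)))

    decPrefixLength<1+ℓ+[k∸ℓ] : ∀ ℓ (v : Word n) → ContentBelow k v →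
      decPrefixLength v < suc (ℓ + (k ∸ ℓ))
    decPrefixLength<1+ℓ+[k∸ℓ] ℓ v content =
      s≤s (ℕ.≤-trans (decPrefixLength-≤ v (ContentBelow⇒All< v content)) (ℕ.m≤n+m∸n k ℓ))

    extractNewLetter : ∀ {w} → count t w ≡ 1 → (∀ i → i ≢ t → count i w ≡ αBelow (suc k) i) →
      ¬ WeakInc3 w →
      ∃[ p ] ∃[ v ] (S3Below k v × p ≤ decPrefixLength v × w ≡ insert p t v)
    extractNewLetter {w} once others ¬inc with extractFirst t w once
    ... | p , v , p≤ , refl =
      p , v , (content , ¬inc ∘ WeakInc3-resp-⊆ (insert-⊆ p t v)) ,
      ¬WeakInc3-insert⁻ p v (ContentBelow⇒All<t v content) p≤ ¬inc , refl
      where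
      content : ContentBelow k v
      content i with i ≟ t
      ... | yes refl = trans (ℕ.suc-injective (trans (sym (count-insert-≡ p t v)) once)) (sym αBelow-old)
      ... | no i≢t   =
        trans (sym (count-insert-≢ p v (i≢t ∘ sym))) (trans (others i i≢t) (αBelow-suc-≢ t≡k i≢t))

    module _ (card : ∀ j → HasCard (S3BelowPrefix k j) (ballot k j)) (ℓ : ℕ) where

      single : lookup α t ≡ 1 → HasCard (S3BelowPrefix (suc k) (suc ℓ)) (ballot (suc k) (suc ℓ))
      single α-t≡1 =
        HasCard-resp join split
          (HasCard-⊎ disjoint (HasCard-Image (insert 0 t) (insert-injective 0 t) (card ℓ))
            (HasCard-⋃Range-Image (insert (suc ℓ) t) (insert-injective (suc ℓ) t)
              (S3BelowPrefix k) (ballot k) (S3BelowPrefix-functional k) card (suc ℓ) (k ∸ ℓ)))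
        where
        Front Inner : Word n → Set
        Front = Image (insert 0 t) (S3BelowPrefix k ℓ)
        Inner = ⋃Range (suc ℓ) (k ∸ ℓ) (λ j → Image (insert (suc ℓ) t) (S3BelowPrefix k j))

        content : ∀ p (v : Word n) → ContentBelow k v → ContentBelow (suc k) (insert p t v)
        content p v c i with i ≟ t
        ... | yes refl = trans (count-insert-new p v c) (sym (trans αBelow-new α-t≡1))
        ... | no i≢t   = count-insert-old p v c i i≢t

        disjoint : ∀ w → Front w → ¬ Inner w
        disjoint _ _ (_ , () , _ , [] , (_ , refl) , _)
        disjoint _ (_ , _ , refl) (_ , _ , _ , _ ∷ _ , ((c , _) , _) , refl) =
          ℕ.<-irrefl refl (All.head (ContentBelow⇒All<t _ c))

        join : ∀ w → Front w ⊎ Inner w → S3BelowPrefix (suc k) (suc ℓ) w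
        join _ (inj₁ (v , ((c , ¬inc) , dpl≡ℓ) , refl)) =
          (content 0 v c , ¬WeakInc3-insert 0 v (ContentBelow⇒All<t v c) z≤n ¬inc) ,
          trans (decPrefixLength-∷-max v (ContentBelow⇒All<t v c)) (cong suc dpl≡ℓ)
        join _ (inj₂ (_ , 1+ℓ≤j , _ , v , ((c , ¬inc) , refl) , refl)) =
          (content (suc ℓ) v c , ¬WeakInc3-insert (suc ℓ) v (ContentBelow⇒All<t v c) 1+ℓ≤j ¬inc) ,
          decPrefixLength-insert ℓ v (ContentBelow⇒All<t v c) 1+ℓ≤j

        split : ∀ w → S3BelowPrefix (suc k) (suc ℓ) w → Front w ⊎ Inner w
        split w ((c , ¬inc) , dpl≡)
          with extractNewLetter (trans (c t) (trans αBelow-new α-t≡1)) (λ i _ → c i) ¬inc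
        ... | zero , v , s3@(cv , _) , _ , refl =
          inj₁ (v , (s3 , ℕ.suc-injective (trans (sym (decPrefixLength-∷-max v (ContentBelow⇒All<t v cv))) dpl≡)) ,
                refl)
        ... | suc p , v , s3@(cv , _) , 1+p≤ , refl
          with trans (sym (decPrefixLength-insert p v (ContentBelow⇒All<t v cv) 1+p≤)) dpl≡
        ...   | refl =
          inj₂ (decPrefixLength v , 1+p≤ , decPrefixLength<1+ℓ+[k∸ℓ] ℓ v cv , v , (s3 , refl) , refl)

      double : lookup α t ≡ 2 → HasCard (S3BelowPrefix (suc k) (suc ℓ)) (ballot (suc k) (suc ℓ))
      double α-t≡2 =
        HasCard-resp join split
          (HasCard-⋃Range-Image twice twice-injective
            (S3BelowPrefix k) (ballot k) (S3BelowPrefix-functional k) card ℓ (suc (k ∸ ℓ)))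
        where
        twice : Word n → Word n
        twice v = t ∷ insert ℓ t v

        twice-injective : Injective _≡_ _≡_ twice
        twice-injective = insert-injective ℓ t ∘ proj₂ ∘ List.∷-injective

        Twice : Word n → Set
        Twice = ⋃Range ℓ (suc (k ∸ ℓ)) (λ j → Image twice (S3BelowPrefix k j))

        content : ∀ v → ContentBelow k v → ContentBelow (suc k) (twice v)
        content v c i with i ≟ t
        ... | yes refl = trans (count-∷-≡ t (insert ℓ t v))
                           (trans (cong suc (count-insert-new ℓ v c)) (sym (trans αBelow-new α-t≡2)))
        ... | no i≢t   = trans (count-∷-≢ (insert ℓ t v) (i≢t ∘ sym)) (count-insert-old ℓ v c i i≢t)

        ¬WeakInc3-twice : ∀ v → All (_<ᶠ t) v → ℓ ≤ decPrefixLength v →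
          ¬ WeakInc3 v → ¬ WeakInc3 (twice v)
        ¬WeakInc3-twice v v<t _  _    (start pair) = ¬IncPairFrom-insert-max ℓ v v<t pair
        ¬WeakInc3-twice v v<t ℓ≤ ¬inc (skip inc)   = ¬WeakInc3-insert ℓ v v<t ℓ≤ ¬inc inc

        join : ∀ w → Twice w → S3BelowPrefix (suc k) (suc ℓ) w
        join _ (_ , ℓ≤j , _ , v , ((c , ¬inc) , refl) , refl) =
          (content v c , ¬WeakInc3-twice v (ContentBelow⇒All<t v c) ℓ≤j ¬inc) ,
          decPrefixLength-∷-insert ℓ v (ContentBelow⇒All<t v c) ℓ≤j

        count-t≡2 : ∀ w → ContentBelow (suc k) w → count t w ≡ 2
        count-t≡2 w c = trans (c t) (trans αBelow-new α-t≡2)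

        split : ∀ w → S3BelowPrefix (suc k) (suc ℓ) w → Twice w
        split [] ((c , _) , _) with count-t≡2 [] c
        ... | ()
        split (x ∷ w) ((c , ¬inc) , dpl≡) with x ≟ t
        ... | no x≢t =
          ⊥-elim (¬inc (start (count≡2⇒IncPairFrom w
            (subst (toℕ x ≤_) (sym t≡k) (ℕ.≤-pred (All.head (ContentBelow⇒All< (x ∷ w) c))))
            (trans (sym (count-∷-≢ w x≢t)) (count-t≡2 (x ∷ w) c)))))
        ... | yes refl
          with extractNewLetter (ℕ.suc-injective (trans (sym (count-∷-≡ t w)) (count-t≡2 (t ∷ w) c)))
                       (λ i i≢t → trans (sym (count-∷-≢ w (i≢t ∘ sym))) (c i)) (¬inc ∘ skip)
        ...   | p , v , s3@(cv , _) , p≤ , refl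
          with ℕ.suc-injective (trans (sym (decPrefixLength-∷-insert p v (ContentBelow⇒All<t v cv) p≤)) dpl≡)
        ...     | refl =
          decPrefixLength v , p≤ ,
          subst (decPrefixLength v <_) (sym (ℕ.+-suc ℓ (k ∸ ℓ))) (decPrefixLength<1+ℓ+[k∸ℓ] ℓ v cv) ,
          v , (s3 , refl) , refl

  S3BelowPrefix-card : AllOneOrTwo α → ∀ k → k ≤ n → ∀ ℓ → HasCard (S3BelowPrefix k ℓ) (ballot k ℓ)
  S3BelowPrefix-card _ zero _ zero =
    HasCard-singleton [] ((empty , λ ()) , refl) (λ w ((c , _) , _) → ContentBelow-zero⇒[] w c)
    where
    empty : ContentBelow 0 []
    empty i = sym (αBelow-≥ {i = i} z≤n)
  S3BelowPrefix-card _ zero _ (suc ℓ) =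
    HasCard-∅ λ w ((c , _) , dpl≡) →
      ℕ.0≢1+n (trans (sym (cong decPrefixLength (ContentBelow-zero⇒[] w c))) dpl≡)
  S3BelowPrefix-card a12 (suc k) k<n zero = HasCard-∅ nonempty
    where
    t = fromℕ< k<n
    open NewLetter (Fin.toℕ-fromℕ< k<n)
    nonempty : ∀ w → ¬ S3BelowPrefix (suc k) zero w
    nonempty w ((c , _) , dpl≡0) with decPrefixLength≡0⇒[] w dpl≡0 | a12 t
    ... | refl | inj₁ α-t≡1 = ℕ.0≢1+n (trans (trans (c t) αBelow-new) α-t≡1)
    ... | refl | inj₂ α-t≡2 = ℕ.0≢1+n (trans (trans (c t) αBelow-new) α-t≡2)
  S3BelowPrefix-card a12 (suc k) k<n (suc ℓ) with a12 (fromℕ< k<n)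
  ... | inj₁ α-t≡1 = NewLetter.single (Fin.toℕ-fromℕ< k<n) (S3BelowPrefix-card a12 k (ℕ.<⇒≤ k<n)) ℓ α-t≡1
  ... | inj₂ α-t≡2 = NewLetter.double (Fin.toℕ-fromℕ< k<n) (S3BelowPrefix-card a12 k (ℕ.<⇒≤ k<n)) ℓ α-t≡2

  InS3-card : AllOneOrTwo α → HasCard (InS3 α) (ballot (suc n) 1)
  InS3-card a12 =
    HasCard-resp toInS3 fromInS3
      (HasCard-⋃Range (S3BelowPrefix n) (ballot n) (S3BelowPrefix-functional n)
        (S3BelowPrefix-card a12 n ℕ.≤-refl) 0 (suc n))
    where
    toInS3 : ∀ w → ⋃Range 0 (suc n) (S3BelowPrefix n) w → InS3 α w
    toInS3 w (_ , _ , _ , (c , ¬inc) , _) =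
      (λ i → trans (c i) (αBelow-< {k = n} (Fin.toℕ<n i))) , ¬inc ∘ HasWeakInc3⇒WeakInc3 w
    fromInS3 : ∀ w → InS3 α w → ⋃Range 0 (suc n) (S3BelowPrefix n) w
    fromInS3 w (c , ¬has) =
      decPrefixLength w , z≤n , s≤s (decPrefixLength-≤ w (ContentBelow⇒All< w c′)) ,
      (c′ , ¬has ∘ WeakInc3⇒HasWeakInc3) , refl
      where
      c′ : ContentBelow n w
      c′ i = trans (c i) (sym (αBelow-< {k = n} (Fin.toℕ<n i)))

≢1,2⇒≥3 : ∀ {m} → 0 < m → ¬ ((m ≡ 1) ⊎ (m ≡ 2)) → ∃[ c ] m ≡ 3 + c
≢1,2⇒≥3 {suc zero}          _ ∉ = ⊥-elim (∉ (inj₁ refl))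
≢1,2⇒≥3 {suc (suc zero)}    _ ∉ = ⊥-elim (∉ (inj₂ refl))
≢1,2⇒≥3 {suc (suc (suc c))} _ _ = c , refl

InS3-empty : ∀ {n} (α : Vec ℕ n) → (∀ i → 0 < lookup α i) → ¬ AllOneOrTwo α → HasCard (InS3 α) 0
InS3-empty {n} α pos ¬a12 = HasCard-∅ λ w (c , ¬has) →
  let i , α-i∉ = Fin.¬∀⟶∃¬ n _ (λ i → (lookup α i ℕ.≟ 1) ⊎-dec (lookup α i ℕ.≟ 2)) ¬a12
      _ , α-i≡3+ = ≢1,2⇒≥3 (pos i) α-i∉
  in ¬has (WeakInc3⇒HasWeakInc3 (count≡3⇒WeakInc3 i w (trans (c i) α-i≡3+)))

-- Ballot numbers and the Catalan number

ballot-step : ∀ k ℓ → ballot (suc k) (suc ℓ) ≡ ballot k ℓ + ballot (suc k) (suc (suc ℓ))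
ballot-step k ℓ = cong (ballot k ℓ +_) tail
  where
  tail : sumFrom (suc ℓ) (k ∸ ℓ) (ballot k) ≡ ballot (suc k) (suc (suc ℓ))
  tail rewrite sym (ℕ.pred[m∸n]≡m∸[1+n] k ℓ) with k ∸ ℓ in eq
  ... | zero  = sym (cong (_+ 0) (ballot-> {k} {suc ℓ} (s≤s (ℕ.m∸n≡0⇒m≤n eq))))
  ... | suc _ = refl

ballot-diag : ∀ ℓ → ballot ℓ ℓ ≡ 1
ballot-diag zero    = refl
ballot-diag (suc ℓ) = trans (ballot-step ℓ ℓ) (cong₂ _+_ (ballot-diag ℓ) (ballot-> (ℕ.n<1+n (suc ℓ))))

pascal : ∀ m k → suc m C suc k ≡ m C k + m C suc k
pascal m k = sym (nCk+nC[k+1]≡[n+1]C[k+1] m k)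

[1+2a]Ca≡[1+2a]C[1+a] : ∀ a → suc (a + a) C a ≡ suc (a + a) C suc a
[1+2a]Ca≡[1+2a]C[1+a] a =
  trans (nCk≡nC[n∸k] (ℕ.≤-trans (ℕ.m≤m+n a a) (ℕ.n≤1+n (a + a))))
        (cong (suc (a + a) C_) (trans (ℕ.+-∸-assoc 1 (ℕ.m≤m+n a a)) (cong suc (ℕ.m+n∸n≡m a a))))

-- ballot (k+1) (ℓ+1) = C(s, k) - C(s, k+1) with s = 2k - ℓ, stated without subtraction.
BallotFormula : ℕ → ℕ → ℕ → Set
BallotFormula ℓ k s = ballot (suc k) (suc ℓ) + s C suc k ≡ s C k

ballotFormula-diag : ∀ ℓ → BallotFormula ℓ ℓ ℓ
ballotFormula-diag ℓ = trans (cong₂ _+_ (ballot-diag (suc ℓ)) (k>n⇒nCk≡0 (ℕ.n<1+n ℓ))) (sym (nCn≡1 ℓ))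

ballotFormula-step : ∀ ℓ k s → BallotFormula (suc (suc ℓ)) (suc k) s → BallotFormula ℓ k s →
  BallotFormula (suc ℓ) (suc k) (suc s)
ballotFormula-step ℓ k s outer inner = begin
  ballot (suc (suc k)) (suc (suc ℓ)) + suc s C suc (suc k)
    ≡⟨ cong₂ _+_ (ballot-step (suc k) (suc ℓ)) (pascal s (suc k)) ⟩
  (ballot (suc k) (suc ℓ) + ballot (suc (suc k)) (suc (suc (suc ℓ)))) + (s C suc k + s C suc (suc k))
    ≡⟨ interchange (ballot (suc k) (suc ℓ)) (ballot (suc (suc k)) (suc (suc (suc ℓ))))
                   (s C suc k) (s C suc (suc k)) ⟩
  (ballot (suc k) (suc ℓ) + s C suc k) + (ballot (suc (suc k)) (suc (suc (suc ℓ))) + s C suc (suc k))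
    ≡⟨ cong₂ _+_ inner outer ⟩
  s C k + s C suc k
    ≡⟨ pascal s k ⟨
  suc s C suc k ∎
  where open ≡-Reasoning

ballotFormula-step₀ : ∀ a → BallotFormula 1 (suc a) (suc (a + a)) → BallotFormula 0 (suc a) (suc (suc (a + a)))
ballotFormula-step₀ a outer = begin
  ballot (suc (suc a)) 1 + suc s C suc (suc a)
    ≡⟨ cong₂ _+_ (ballot-step (suc a) 0) (pascal s (suc a)) ⟩
  ballot (suc (suc a)) 2 + (s C suc a + s C suc (suc a))
    ≡⟨ x∙yz≈y∙xz (ballot (suc (suc a)) 2) (s C suc a) (s C suc (suc a)) ⟩
  s C suc a + (ballot (suc (suc a)) 2 + s C suc (suc a))
    ≡⟨ cong (s C suc a +_) outer ⟩
  s C suc a + s C suc a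
    ≡⟨ cong (_+ s C suc a) ([1+2a]Ca≡[1+2a]C[1+a] a) ⟨
  s C a + s C suc a
    ≡⟨ pascal s a ⟨
  suc s C suc a ∎
  where
  open ≡-Reasoning
  s = suc (a + a)

ballotFormula : ∀ a ℓ → BallotFormula ℓ (ℓ + a) (ℓ + a + a)
ballotFormula zero    ℓ       rewrite ℕ.+-identityʳ ℓ | ℕ.+-identityʳ ℓ = ballotFormula-diag ℓ
ballotFormula (suc a) zero    rewrite ℕ.+-suc a a = ballotFormula-step₀ a (ballotFormula a 1)
ballotFormula (suc a) (suc ℓ) =
  ballotFormula-step ℓ (ℓ + suc a) (ℓ + suc a + suc a) outer (ballotFormula (suc a) ℓ)
  where
  outer : BallotFormula (suc (suc ℓ)) (suc (ℓ + suc a)) (ℓ + suc a + suc a)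
  outer = subst₂ (BallotFormula (suc (suc ℓ))) (cong suc (sym (ℕ.+-suc ℓ a)))
    (sym (trans (ℕ.+-suc (ℓ + suc a) a) (cong (λ x → suc (x + a)) (ℕ.+-suc ℓ a))))
    (ballotFormula a (suc (suc ℓ)))

[1+k]*[1+m]C[1+k]≡[1+m]*mCk : ∀ m k → suc k * (suc m C suc k) ≡ suc m * (m C k)
[1+k]*[1+m]C[1+k]≡[1+m]*mCk zero    zero    = refl
[1+k]*[1+m]C[1+k]≡[1+m]*mCk zero    (suc k)
  rewrite k>n⇒nCk≡0 {1} {suc (suc k)} (s≤s (s≤s z≤n)) | k>n⇒nCk≡0 {0} {suc k} (s≤s z≤n) =
  ℕ.*-zeroʳ (suc (suc k))
[1+k]*[1+m]C[1+k]≡[1+m]*mCk (suc m) zero    =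
  trans (ℕ.+-identityʳ _) (trans (nC1≡n (suc (suc m))) (sym (ℕ.*-identityʳ _)))
[1+k]*[1+m]C[1+k]≡[1+m]*mCk (suc m) (suc k) = begin
  suc (suc k) * (suc (suc m) C suc (suc k))
    ≡⟨ cong (suc (suc k) *_) (pascal (suc m) (suc k)) ⟩
  suc (suc k) * (X + Y)
    ≡⟨ solve 3 (λ k X Y → (con 2 :+ k) :* (X :+ Y) := X :+ ((con 1 :+ k) :* X :+ (con 2 :+ k) :* Y)) refl k X Y ⟩
  X + (suc k * X + suc (suc k) * Y)
    ≡⟨ cong (X +_) (cong₂ _+_ ([1+k]*[1+m]C[1+k]≡[1+m]*mCk m k) ([1+k]*[1+m]C[1+k]≡[1+m]*mCk m (suc k))) ⟩
  X + (suc m * (m C k) + suc m * (m C suc k))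
    ≡⟨ cong (X +_) (ℕ.*-distribˡ-+ (suc m) (m C k) (m C suc k)) ⟨
  X + suc m * (m C k + m C suc k)
    ≡⟨ cong (λ z → X + suc m * z) (pascal m k) ⟨
  suc (suc m) * X ∎
  where
  open ≡-Reasoning
  open +-*-Solver
  X = suc m C suc k
  Y = suc m C suc (suc k)

[1+n]*[2n]C[1+n]≡n*[2n]Cn : ∀ n → suc n * ((n + n) C suc n) ≡ n * ((n + n) C n)
[1+n]*[2n]C[1+n]≡n*[2n]Cn zero    = refl
[1+n]*[2n]C[1+n]≡n*[2n]Cn (suc n) = begin
  suc (suc n) * (suc m C suc (suc n)) ≡⟨ [1+k]*[1+m]C[1+k]≡[1+m]*mCk m (suc n) ⟩
  suc m * (m C suc n)                 ≡⟨ cong (suc m *_) central ⟨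
  suc m * (m C n)                     ≡⟨ [1+k]*[1+m]C[1+k]≡[1+m]*mCk m n ⟨
  suc n * (suc m C suc n)             ∎
  where
  open ≡-Reasoning
  m = n + suc n
  central : m C n ≡ m C suc n
  central = subst (λ z → z C n ≡ z C suc n) (sym (ℕ.+-suc n n)) ([1+2a]Ca≡[1+2a]C[1+a] n)

ballot≡catalan : ∀ n → ballot (suc n) 1 ≡ catalan n
ballot≡catalan n = sym (trans (cong (_/ suc n) (sym [1+n]*ballot≡[2n]Cn)) (m*n/n≡m b (suc n)))
  where
  b = ballot (suc n) 1
  [1+n]*ballot≡[2n]Cn : b * suc n ≡ (n + n) C n
  [1+n]*ballot≡[2n]Cn = trans (ℕ.*-comm b (suc n)) (ℕ.+-cancelʳ-≡ (n * ((n + n) C n)) _ _ (begin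
    suc n * b + n * ((n + n) C n)          ≡⟨ cong (suc n * b +_) ([1+n]*[2n]C[1+n]≡n*[2n]Cn n) ⟨
    suc n * b + suc n * ((n + n) C suc n)  ≡⟨ ℕ.*-distribˡ-+ (suc n) b _ ⟨
    suc n * (b + (n + n) C suc n)          ≡⟨ cong (suc n *_) (ballotFormula n 0) ⟩
    suc n * ((n + n) C n)                  ∎))
    where open ≡-Reasoning

corollary5p4 : (n : ℕ) (α : Vec ℕ n) → ((i : Fin n) → 0 < lookup α i) →
    (AllOneOrTwo α → HasCard (InS3 α) (catalan n)) ×
    (¬ AllOneOrTwo α → HasCard (InS3 α) 0)
corollary5p4 n α pos =
  (λ a12 → subst (HasCard (InS3 α)) (ballot≡catalan n) (Stages.InS3-card α a12)) ,
  InS3-empty α pos
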